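{- Let $n$ be a positive integer and $d=a(b+c)=ab+ac$. For $e\in\{b,c\}$ define blocks $L^{(e)}_1,\dots,L^{(e)}_{2n}$ by $L^{(e)}_j=e$ for $j$ odd and $L^{(e)}_j=d$ for $j$ even, and for $0\le i\le 2n$ put $S^{(e)}_i=L^{(e)}_{i+1}\star\cdots\star L^{(e)}_{2n}$, and $P^{(e)}_i=L^{(e)}_1\star\cdots\star L^{(e)}_i$ if $i$ is odd, $P^{(e)}_i=L^{(e)}_i\star L^{(e)}_{i-1}\star\cdots\star L^{(e)}_1$ if $i$ is even (empty product $=\mathbf 1$). Then $$\sum_{i=0}^{2n}(-1)^i\,P^{(c)}_i\sqcup\!\sqcup\, S^{(c)}_i=(-2)^n(ac^2ab^2)^{\lfloor n/2\rfloor}(ac^2)^{2\{n/2\}}$$ and $$\sum_{i=0}^{2n}(-1)^i\,P^{(b)}_i\sqcup\!\sqcup\, S^{(b)}_i=(-2)^n(ab^2ac^2)^{\lfloor n/2\rfloor}(ab^2)^{2\{n/2\}},$$ where $\lfloor x\rfloor$, $\{x\}$ are the integral and fractional parts of $x$ (so the last factor is present exactly when $n$ is odd) and powers are concatenation powers.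
   Context: $\mathfrak A=\mathbb Q\langle a,b,c\rangle$ is the free noncommutative polynomial algebra over $\mathbb Q$ on letters $a,b,c$; $\mathbf 1$ is the empty word. Shuffle product $\sqcup\!\sqcup$: bilinear, $\mathbf 1\sqcup\!\sqcup w=w\sqcup\!\sqcup\mathbf 1=w$, $(xu)\sqcup\!\sqcup(yv)=x(u\sqcup\!\sqcup yv)+y(xu\sqcup\!\sqcup v)$ for letters $x,y$ and words $u,v$. $\star$-concatenation: for words $u,v$, if $u$ ends in $b$ and $v=bv'$ then $u\star v=ucv'$; if $u$ ends in $c$ and $v=cv'$ then $u\star v=ubv'$; otherwise $u\star v=uv$ (so $b\star b=bc$, $c\star c=cb$, and $d\star b=d\star c=a(cb+bc)$). Extend bilinearly; iterated $\star$-products are evaluated left to right. -}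

module Defs where

open import Data.Nat as ℕ using (ℕ; zero; suc; ⌊_/2⌋)
open import Data.Nat.DivMod using (_%_)
open import Data.Bool using (Bool; true; false; if_then_else_)
open import Data.List using (List; []; _∷_; _++_; map; concatMap; foldl; foldr; take; drop; reverse; replicate; concat; upTo)
open import Data.Product using (_×_; _,_)
open import Data.Rational using (ℚ; 0ℚ; 1ℚ; _+_; _*_; -_)
open import Relation.Binary.PropositionalEquality using (_≡_)

data Letter : Set where
  a b c : Letter

Word : Set
Word = List Letter

-- Polynomials in ℚ⟨a,b,c⟩ as finite formal sums (coefficient, word)
Poly : Set
Poly = List (ℚ × Word)

_≟L_ : Letter → Letter → Bool
a ≟L a = true
b ≟L b = true
c ≟L c = true
_ ≟L _ = false

_≟W_ : Word → Word → Bool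
[] ≟W [] = true
(x ∷ u) ≟W (y ∷ v) = if x ≟L y then u ≟W v else false
_ ≟W _ = false

coeff : Poly → Word → ℚ
coeff [] w = 0ℚ
coeff ((q , u) ∷ p) w = (if u ≟W w then q else 0ℚ) + coeff p w

_≈_ : Poly → Poly → Set
p ≈ q = ∀ w → coeff p w ≡ coeff q w
infix 4 _≈_

word : Word → Poly
word w = (1ℚ , w) ∷ []

𝟙 : Poly
𝟙 = word []

scale : ℚ → Poly → Poly
scale q = map (λ { (r , w) → (q * r , w) })

shW : Word → Word → List Word
shW [] v = v ∷ []
shW (x ∷ u) [] = (x ∷ u) ∷ []
shW (x ∷ u) (y ∷ v) = map (x ∷_) (shW u (y ∷ v)) ++ map (y ∷_) (shW (x ∷ u) v)

_ш_ : Poly → Poly → Poly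
p ш q = concatMap (λ { (r , u) → concatMap (λ { (s , v) → map (λ w → (r * s , w)) (shW u v) }) q }) p

endsIn : Letter → Word → Bool
endsIn x [] = false
endsIn x (y ∷ []) = x ≟L y
endsIn x (_ ∷ y ∷ u) = endsIn x (y ∷ u)

starW : Word → Word → Word
starW u (b ∷ v) = if endsIn b u then u ++ (c ∷ v) else u ++ (b ∷ v)
starW u (c ∷ v) = if endsIn c u then u ++ (b ∷ v) else u ++ (c ∷ v)
starW u v = u ++ v

_⋆_ : Poly → Poly → Poly
p ⋆ q = concatMap (λ { (r , u) → map (λ { (s , v) → (r * s , starW u v) }) q }) p

starProd : List Poly → Poly
starProd [] = 𝟙
starProd (x ∷ xs) = foldl _⋆_ x xs

d : Poly
d = (1ℚ , a ∷ b ∷ []) ∷ (1ℚ , a ∷ c ∷ []) ∷ []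

isOdd : ℕ → Bool
isOdd zero = false
isOdd (suc zero) = true
isOdd (suc (suc n)) = isOdd n

L : Letter → ℕ → Poly
L e j = if isOdd j then word (e ∷ []) else d

blocks : Letter → ℕ → List Poly
blocks e n = map (λ k → L e (suc k)) (upTo (2 ℕ.* n))

S : Letter → ℕ → ℕ → Poly
S e n i = starProd (drop i (blocks e n))

P : Letter → ℕ → ℕ → Poly
P e n i = if isOdd i then starProd (take i (blocks e n))
          else starProd (reverse (take i (blocks e n)))

signQ : ℕ → ℚ
signQ i = if isOdd i then - 1ℚ else 1ℚ

powQ : ℚ → ℕ → ℚ
powQ q zero = 1ℚ
powQ q (suc k) = q * powQ q k

_+P_ : Poly → Poly → Poly
p +P q = p ++ q

LHS : Letter → ℕ → Poly
LHS e n = foldr _+P_ [] (map (λ i → scale (signQ i) (P e n i ш S e n i)) (upTo (suc (2 ℕ.* n))))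

wpow : Word → ℕ → Word
wpow w k = concat (replicate k w)

-- (-2)^n (x y)^⌊n/2⌋ x^(2{n/2}) with x = a e1 e1, y = a e2 e2
RHS : Letter → Letter → ℕ → Poly
RHS e1 e2 n = scale (powQ (- (1ℚ + 1ℚ)) n)
  (word (wpow (a ∷ e1 ∷ e1 ∷ a ∷ e2 ∷ e2 ∷ []) ⌊ n /2⌋ ++ wpow (a ∷ e1 ∷ e1 ∷ []) (n % 2)))

module Submission where

-- A polynomial of ℚ⟨a,b,c⟩ is identified with its coefficient function, a
-- series Word → ℚ.  On series the shuffle and the concatenation product are
-- defined by how the left derivatives δ_z f = (w ↦ f (z w)) act on them, and
-- a series is determined by its constant term and its three derivatives.
--
--  * The file first develops the algebra of series: bilinearity and units of the
--    shuffle, associativity of concatenation, and the "bridges" showing that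
--    the coefficient map sends ш and word concatenation of polynomials to the
--    series operations.
--  * Because ab ⋆ e = abc and ac ⋆ e = acb for e ∈ {b,c}, every ⋆-product of
--    blocks is an ordinary concatenation: with m = bc + cb the prefix products
--    are Aₖ = (am)ᵏ and e·Aₖ, the suffix products are Bⱼ = (am)ʲ a(b+c) and
--    e·Bⱼ.  Hence the left-hand side equals the series
--        T e n = Aₙ ш 1 + Σ_{k<n} (Aₖ ш e·B_{n-1-k} − e·Aₖ ш B_{n-1-k}).
--  * For {x,y} = {b,c} we prove T x (M+1) = −2 · a x x (T y M) by comparing
--    derivatives; the derivatives are computed through two auxiliary series
--    U = δ_a T and V = δ_x U, and telescoping of the convolution sums.
--  * Iterating, T x n = (−2)ⁿ · a x x a y y ⋯ (n blocks), which is the RHS.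

open import Defs
open import Data.Nat as ℕ using (ℕ; zero; suc; _∸_; _≤_; _<_; s≤s; z≤n; ⌊_/2⌋)
open import Data.Nat.DivMod using (_%_)
import Data.Nat.Properties as NP
open import Data.Product using (_×_; _,_)
open import Data.Bool using (true; false; if_then_else_)
open import Data.List using (List; []; _∷_; _++_; map; concatMap; foldl; foldr; take; drop; reverse; applyUpTo)
import Data.List.Properties as LP
open import Data.Rational using (ℚ; 0ℚ; 1ℚ; _+_; _*_; -_)
open import Data.Rational.Properties
  using (+-identityˡ; +-identityʳ; +-assoc; +-comm; *-zeroˡ; *-zeroʳ; *-identityˡ; *-identityʳ;
         *-assoc; *-distribˡ-+; *-distribʳ-+; +-0-commutativeMonoid)
open import Data.Rational.Solver
open +-*-Solver using (solve; _:+_; _:*_; _:=_; con)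
open import Algebra.Bundles using (CommutativeMonoid)
open import Algebra.Properties.CommutativeSemigroup
  (CommutativeMonoid.commutativeSemigroup +-0-commutativeMonoid) using (interchange)
open import Relation.Binary.PropositionalEquality
open import Relation.Binary.Bundles using (Setoid)
import Relation.Binary.Reasoning.Setoid as SetoidReasoning

*-pull : ∀ r x y → x * (r * y) ≡ r * (x * y)
*-pull = solve 3 (λ r x y → x :* (r :* y) := r :* (x :* y)) refl

Series : Set
Series = Word → ℚ

infix 4 _≐_
_≐_ : Series → Series → Set
f ≐ g = ∀ w → f w ≡ g w

δ : Letter → Series → Series
δ z f w = f (z ∷ w)

0ˢ : Series
0ˢ _ = 0ℚ

1ˢ : Series
1ˢ [] = 1ℚ
1ˢ (_ ∷ _) = 0ℚ

infixl 6 _⊕_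
_⊕_ : Series → Series → Series
(f ⊕ g) w = f w + g w

scaleˢ : ℚ → Series → Series
scaleˢ r f w = r * f w

pre : Letter → Series → Series
pre z f [] = 0ℚ
pre z f (y ∷ w) = if z ≟L y then f w else 0ℚ

-- Shuffle product, by the Leibniz rule δ_z (f ш g) = δ_z f ш g + f ш δ_z g.
sh : Series → Series → Series
sh f g [] = f [] * g []
sh f g (z ∷ w) = sh (δ z f) g w + sh f (δ z g) w

-- Concatenation product, by δ_z (f g) = (δ_z f) g + f(ε) δ_z g.
cat : Series → Series → Series
cat f g [] = f [] * g []
cat f g (z ∷ w) = cat (δ z f) g w + f [] * g (z ∷ w)

≐-refl : ∀ {f} → f ≐ f
≐-refl w = refl

≐-sym : ∀ {f g} → f ≐ g → g ≐ f
≐-sym p w = sym (p w)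

≐-trans : ∀ {f g h} → f ≐ g → g ≐ h → f ≐ h
≐-trans p q w = trans (p w) (q w)

≐-setoid : Setoid _ _
≐-setoid = record { Carrier = Series ; _≈_ = _≐_
                  ; isEquivalence = record { refl = ≐-refl ; sym = ≐-sym ; trans = ≐-trans } }

δ-cong : ∀ z {f g} → f ≐ g → δ z f ≐ δ z g
δ-cong z p w = p (z ∷ w)

⊕-cong : ∀ {f f' g g'} → f ≐ f' → g ≐ g' → f ⊕ g ≐ f' ⊕ g'
⊕-cong p q w = cong₂ _+_ (p w) (q w)

scaleˢ-cong : ∀ r {f g} → f ≐ g → scaleˢ r f ≐ scaleˢ r g
scaleˢ-cong r p w = cong (r *_) (p w)

pre-cong : ∀ z {f g} → f ≐ g → pre z f ≐ pre z g
pre-cong z p [] = refl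
pre-cong z p (y ∷ w) with z ≟L y
... | true = p w
... | false = refl

pre-⊕ : ∀ z f g → pre z f ⊕ pre z g ≐ pre z (f ⊕ g)
pre-⊕ z f g [] = +-identityʳ 0ℚ
pre-⊕ z f g (y ∷ w) with z ≟L y
... | true = refl
... | false = +-identityʳ 0ℚ

pre-scale : ∀ z r f → pre z (scaleˢ r f) ≐ scaleˢ r (pre z f)
pre-scale z r f [] = sym (*-zeroʳ r)
pre-scale z r f (y ∷ w) with z ≟L y
... | true = refl
... | false = sym (*-zeroʳ r)

sh-cong : ∀ {f f' g g'} → f ≐ f' → g ≐ g' → sh f g ≐ sh f' g'
sh-cong p q [] = cong₂ _*_ (p []) (q [])
sh-cong p q (z ∷ w) = cong₂ _+_ (sh-cong (δ-cong z p) q w) (sh-cong p (δ-cong z q) w)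

sh-0l : ∀ {f} g → f ≐ 0ˢ → sh f g ≐ 0ˢ
sh-0l g p [] = trans (cong (_* g []) (p [])) (*-zeroˡ (g []))
sh-0l g p (z ∷ w) = trans (cong₂ _+_ (sh-0l g (δ-cong z p) w) (sh-0l (δ z g) p w)) (+-identityʳ 0ℚ)

sh-0r : ∀ f {g} → g ≐ 0ˢ → sh f g ≐ 0ˢ
sh-0r f p [] = trans (cong (f [] *_) (p [])) (*-zeroʳ (f []))
sh-0r f p (z ∷ w) = trans (cong₂ _+_ (sh-0r (δ z f) p w) (sh-0r f (δ-cong z p) w)) (+-identityʳ 0ℚ)

sh-addl : ∀ f g h → sh (f ⊕ g) h ≐ sh f h ⊕ sh g h
sh-addl f g h [] = *-distribʳ-+ (h []) (f []) (g [])
sh-addl f g h (z ∷ w) =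
  trans (cong₂ _+_ (sh-addl (δ z f) (δ z g) h w) (sh-addl f g (δ z h) w))
        (interchange (sh (δ z f) h w) (sh (δ z g) h w) (sh f (δ z h) w) (sh g (δ z h) w))

sh-addr : ∀ f g h → sh f (g ⊕ h) ≐ sh f g ⊕ sh f h
sh-addr f g h [] = *-distribˡ-+ (f []) (g []) (h [])
sh-addr f g h (z ∷ w) =
  trans (cong₂ _+_ (sh-addr (δ z f) g h w) (sh-addr f (δ z g) (δ z h) w))
        (interchange (sh (δ z f) g w) (sh (δ z f) h w) (sh f (δ z g) w) (sh f (δ z h) w))

sh-scalel : ∀ r f g → sh (scaleˢ r f) g ≐ scaleˢ r (sh f g)
sh-scalel r f g [] = *-assoc r (f []) (g [])
sh-scalel r f g (z ∷ w) =
  trans (cong₂ _+_ (sh-scalel r (δ z f) g w) (sh-scalel r f (δ z g) w))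
        (sym (*-distribˡ-+ r _ _))

sh-scaler : ∀ r f g → sh f (scaleˢ r g) ≐ scaleˢ r (sh f g)
sh-scaler r f g [] = *-pull r (f []) (g [])
sh-scaler r f g (z ∷ w) =
  trans (cong₂ _+_ (sh-scaler r (δ z f) g w) (sh-scaler r f (δ z g) w))
        (sym (*-distribˡ-+ r _ _))

δ-1ˢ : ∀ z → δ z 1ˢ ≐ 0ˢ
δ-1ˢ z w = refl

sh-1r : ∀ f → sh f 1ˢ ≐ f
sh-1r f [] = *-identityʳ (f [])
sh-1r f (z ∷ w) = trans (cong₂ _+_ (sh-1r (δ z f) w) (sh-0r f (δ-1ˢ z) w)) (+-identityʳ _)

sh-1l : ∀ g → sh 1ˢ g ≐ g
sh-1l g [] = *-identityˡ (g [])
sh-1l g (z ∷ w) = trans (cong₂ _+_ (sh-0l g (δ-1ˢ z) w) (sh-1l (δ z g) w)) (+-identityˡ _)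

cat-cong : ∀ {f f' g g'} → f ≐ f' → g ≐ g' → cat f g ≐ cat f' g'
cat-cong p q [] = cong₂ _*_ (p []) (q [])
cat-cong p q (z ∷ w) = cong₂ _+_ (cat-cong (δ-cong z p) q w) (cong₂ _*_ (p []) (q (z ∷ w)))

cat-0l : ∀ {f} g → f ≐ 0ˢ → cat f g ≐ 0ˢ
cat-0l g p [] = trans (cong (_* g []) (p [])) (*-zeroˡ (g []))
cat-0l g p (z ∷ w) =
  trans (cong₂ _+_ (cat-0l g (δ-cong z p) w) (trans (cong (_* g (z ∷ w)) (p [])) (*-zeroˡ (g (z ∷ w)))))
        (+-identityʳ 0ℚ)

cat-0r : ∀ f {g} → g ≐ 0ˢ → cat f g ≐ 0ˢ
cat-0r f p [] = trans (cong (f [] *_) (p [])) (*-zeroʳ (f []))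
cat-0r f p (z ∷ w) =
  trans (cong₂ _+_ (cat-0r (δ z f) p w) (trans (cong (f [] *_) (p (z ∷ w))) (*-zeroʳ (f []))))
        (+-identityʳ 0ℚ)

cat-addl : ∀ f g h → cat (f ⊕ g) h ≐ cat f h ⊕ cat g h
cat-addl f g h [] = *-distribʳ-+ (h []) (f []) (g [])
cat-addl f g h (z ∷ w) =
  trans (cong₂ _+_ (cat-addl (δ z f) (δ z g) h w) (*-distribʳ-+ (h (z ∷ w)) (f []) (g [])))
        (interchange (cat (δ z f) h w) (cat (δ z g) h w) (f [] * h (z ∷ w)) (g [] * h (z ∷ w)))

cat-addr : ∀ f g h → cat f (g ⊕ h) ≐ cat f g ⊕ cat f h
cat-addr f g h [] = *-distribˡ-+ (f []) (g []) (h [])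
cat-addr f g h (z ∷ w) =
  trans (cong₂ _+_ (cat-addr (δ z f) g h w) (*-distribˡ-+ (f []) (g (z ∷ w)) (h (z ∷ w))))
        (interchange (cat (δ z f) g w) (cat (δ z f) h w) (f [] * g (z ∷ w)) (f [] * h (z ∷ w)))

cat-scalel : ∀ r f g → cat (scaleˢ r f) g ≐ scaleˢ r (cat f g)
cat-scalel r f g [] = *-assoc r (f []) (g [])
cat-scalel r f g (z ∷ w) =
  trans (cong₂ _+_ (cat-scalel r (δ z f) g w) (*-assoc r (f []) _))
        (sym (*-distribˡ-+ r _ _))

cat-scaler : ∀ r f g → cat f (scaleˢ r g) ≐ scaleˢ r (cat f g)
cat-scaler r f g [] = *-pull r (f []) (g [])
cat-scaler r f g (z ∷ w) =
  trans (cong₂ _+_ (cat-scaler r (δ z f) g w) (*-pull r (f []) (g (z ∷ w))))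
        (sym (*-distribˡ-+ r _ _))

cat-1l : ∀ g → cat 1ˢ g ≐ g
cat-1l g [] = *-identityˡ (g [])
cat-1l g (z ∷ w) = trans (cong₂ _+_ (cat-0l g (δ-1ˢ z) w) (*-identityˡ (g (z ∷ w)))) (+-identityˡ (g (z ∷ w)))

cat-1r : ∀ f → cat f 1ˢ ≐ f
cat-1r f [] = *-identityʳ (f [])
cat-1r f (z ∷ w) = trans (cong₂ _+_ (cat-1r (δ z f) w) (*-zeroʳ (f []))) (+-identityʳ _)

-- Associativity, needed to absorb each new factor d ⋆ e into a product.
cat-assoc : ∀ f g h → cat (cat f g) h ≐ cat f (cat g h)
cat-assoc f g h [] = *-assoc (f []) (g []) (h [])
cat-assoc f g h (z ∷ w) =
  trans (cong (_+ (f [] * g []) * h (z ∷ w))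
          (trans (cat-addl (cat (δ z f) g) (scaleˢ (f []) (δ z g)) h w)
                 (cong₂ _+_ (cat-assoc (δ z f) g h w) (cat-scalel (f []) (δ z g) h w))))
        (solve 5 (λ A x y B H → (A :+ x :* B) :+ (x :* y) :* H := A :+ x :* (B :+ y :* H)) refl
           (cat (δ z f) (cat g h) w) (f []) (g []) (cat (δ z g) h w) (h (z ∷ w)))

cat-pre : ∀ z f g → cat (pre z f) g ≐ pre z (cat f g)
cat-pre z f g [] = *-zeroˡ (g [])
cat-pre z f g (y ∷ w) with z ≟L y
... | true = trans (cong (cat f g w +_) (*-zeroˡ (g (y ∷ w)))) (+-identityʳ (cat f g w))
... | false = trans (cong₂ _+_ (cat-0l {0ˢ} g ≐-refl w) (*-zeroˡ (g (y ∷ w)))) (+-identityʳ 0ℚ)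

mono : ℚ → Word → Series
mono r u w = if u ≟W w then r else 0ℚ

mono-cong : ∀ {r r' u u'} → r ≡ r' → u ≡ u' → mono r u ≐ mono r' u'
mono-cong refl refl w = refl

mono-scale : ∀ r s u w → mono (r * s) u w ≡ r * mono s u w
mono-scale r s u w with u ≟W w
... | true = refl
... | false = sym (*-zeroʳ r)

mono-as-scale : ∀ r u → mono r u ≐ scaleˢ r (mono 1ℚ u)
mono-as-scale r u w with u ≟W w
... | true = sym (*-identityʳ r)
... | false = sym (*-zeroʳ r)

mono-nil : mono 1ℚ [] ≐ 1ˢ
mono-nil [] = refl
mono-nil (_ ∷ _) = refl

mono-cons : ∀ r z u → mono r (z ∷ u) ≐ pre z (mono r u)
mono-cons r z u [] = refl
mono-cons r z u (y ∷ w) with z ≟L y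
... | true = refl
... | false = refl

wordˢ : Word → Series
wordˢ = foldr pre 1ˢ

mono-word : ∀ u → mono 1ℚ u ≐ wordˢ u
mono-word [] = mono-nil
mono-word (z ∷ u) = ≐-trans (mono-cons 1ℚ z u) (pre-cong z (mono-word u))

coeff-≡ : ∀ {p q} → p ≡ q → coeff p ≐ coeff q
coeff-≡ refl w = refl

coeff-++ : ∀ p q w → coeff (p ++ q) w ≡ coeff p w + coeff q w
coeff-++ [] q w = sym (+-identityˡ _)
coeff-++ ((r , u) ∷ p) q w =
  trans (cong (mono r u w +_) (coeff-++ p q w)) (sym (+-assoc (mono r u w) (coeff p w) (coeff q w)))

coeff-scale : ∀ r p w → coeff (scale r p) w ≡ r * coeff p w
coeff-scale r [] w = sym (*-zeroʳ r)
coeff-scale r ((s , u) ∷ p) w =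
  trans (cong₂ _+_ (mono-scale r s u w) (coeff-scale r p w)) (sym (*-distribˡ-+ r _ _))

coeff-word : ∀ u → coeff (word u) ≐ mono 1ℚ u
coeff-word u w = +-identityʳ _

coeff-𝟙 : coeff 𝟙 ≐ 1ˢ
coeff-𝟙 = ≐-trans (coeff-word []) mono-nil

withCoeff : ℚ → List Word → Poly
withCoeff k L = map (λ w → (k , w)) L

coeff-withCoeff-++ : ∀ k L₁ L₂ w →
  coeff (withCoeff k (L₁ ++ L₂)) w ≡ coeff (withCoeff k L₁) w + coeff (withCoeff k L₂) w
coeff-withCoeff-++ k L₁ L₂ w =
  trans (cong (λ l → coeff l w) (LP.map-++ (λ w → (k , w)) L₁ L₂)) (coeff-++ (withCoeff k L₁) (withCoeff k L₂) w)

coeff-cons-nil : ∀ k x L → coeff (withCoeff k (map (x ∷_) L)) [] ≡ 0ℚ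
coeff-cons-nil k x [] = refl
coeff-cons-nil k x (u ∷ L) = trans (cong (0ℚ +_) (coeff-cons-nil k x L)) (+-identityʳ 0ℚ)

coeff-cons-match : ∀ k {x z} L w → x ≟L z ≡ true →
  coeff (withCoeff k (map (x ∷_) L)) (z ∷ w) ≡ coeff (withCoeff k L) w
coeff-cons-match k [] w eq = refl
coeff-cons-match k {x} {z} (u ∷ L) w eq rewrite eq = cong (mono k u w +_) (coeff-cons-match k L w eq)

coeff-cons-mismatch : ∀ k {x z} L w → x ≟L z ≡ false →
  coeff (withCoeff k (map (x ∷_) L)) (z ∷ w) ≡ 0ℚ
coeff-cons-mismatch k [] w eq = refl
coeff-cons-mismatch k {x} {z} (u ∷ L) w eq rewrite eq =
  trans (cong (0ℚ +_) (coeff-cons-mismatch k L w eq)) (+-identityʳ 0ℚ)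

coeff-cons-shˡ : ∀ k x u z w (L : List Word) g →
  coeff (withCoeff k L) w ≡ k * sh (mono 1ℚ u) g w →
  coeff (withCoeff k (map (x ∷_) L)) (z ∷ w) ≡ k * sh (δ z (mono 1ℚ (x ∷ u))) g w
coeff-cons-shˡ k x u z w L g ih with x ≟L z in eq
... | true = trans (coeff-cons-match k L w eq) ih
... | false = trans (coeff-cons-mismatch k L w eq) (sym (trans (cong (k *_) (sh-0l {0ˢ} g ≐-refl w)) (*-zeroʳ k)))

coeff-cons-shʳ : ∀ k y v z w (L : List Word) f →
  coeff (withCoeff k L) w ≡ k * sh f (mono 1ℚ v) w →
  coeff (withCoeff k (map (y ∷_) L)) (z ∷ w) ≡ k * sh f (δ z (mono 1ℚ (y ∷ v))) w
coeff-cons-shʳ k y v z w L f ih with y ≟L z in eq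
... | true = trans (coeff-cons-match k L w eq) ih
... | false = trans (coeff-cons-mismatch k L w eq) (sym (trans (cong (k *_) (sh-0r f {0ˢ} ≐-refl w)) (*-zeroʳ k)))

coeff-shW : ∀ w u v k → coeff (withCoeff k (shW u v)) w ≡ k * sh (mono 1ℚ u) (mono 1ℚ v) w
coeff-shW w [] v k =
  trans (trans (+-identityʳ _) (mono-as-scale k v w))
        (cong (k *_) (sym (trans (sh-cong mono-nil ≐-refl w) (sh-1l (mono 1ℚ v) w))))
coeff-shW w (x ∷ u) [] k =
  trans (trans (+-identityʳ _) (mono-as-scale k (x ∷ u) w))
        (cong (k *_) (sym (trans (sh-cong ≐-refl mono-nil w) (sh-1r (mono 1ℚ (x ∷ u)) w))))
coeff-shW [] (x ∷ u) (y ∷ v) k =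
  trans (coeff-withCoeff-++ k (map (x ∷_) (shW u (y ∷ v))) (map (y ∷_) (shW (x ∷ u) v)) [])
   (trans (cong₂ _+_ (coeff-cons-nil k x (shW u (y ∷ v))) (coeff-cons-nil k y (shW (x ∷ u) v)))
     (trans (+-identityʳ 0ℚ) (sym (trans (cong (k *_) (*-zeroˡ 0ℚ)) (*-zeroʳ k)))))
coeff-shW (z ∷ w) (x ∷ u) (y ∷ v) k =
  trans (coeff-withCoeff-++ k (map (x ∷_) (shW u (y ∷ v))) (map (y ∷_) (shW (x ∷ u) v)) (z ∷ w))
   (trans (cong₂ _+_ (coeff-cons-shˡ k x u z w (shW u (y ∷ v)) (mono 1ℚ (y ∷ v)) (coeff-shW w u (y ∷ v) k))
                     (coeff-cons-shʳ k y v z w (shW (x ∷ u) v) (mono 1ℚ (x ∷ u)) (coeff-shW w (x ∷ u) v k)))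
          (sym (*-distribˡ-+ k _ _)))

sh-mono : ∀ r s u v → sh (mono r u) (mono s v) ≐ scaleˢ (r * s) (sh (mono 1ℚ u) (mono 1ℚ v))
sh-mono r s u v w =
  trans (sh-cong (mono-as-scale r u) (mono-as-scale s v) w)
   (trans (sh-scalel r (mono 1ℚ u) (scaleˢ s (mono 1ℚ v)) w)
    (trans (cong (r *_) (sh-scaler s (mono 1ℚ u) (mono 1ℚ v) w))
      (sym (*-assoc r s _))))

coeff-shuffle-term : ∀ r u q w →
  coeff (concatMap (λ { (s , v) → map (λ w → (r * s , w)) (shW u v) }) q) w ≡ sh (mono r u) (coeff q) w
coeff-shuffle-term r u [] w = sym (sh-0r (mono r u) ≐-refl w)
coeff-shuffle-term r u ((s , v) ∷ q) w =
  trans (coeff-++ (withCoeff (r * s) (shW u v)) _ w)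
   (trans (cong₂ _+_ (trans (coeff-shW w u v (r * s)) (sym (sh-mono r s u v w))) (coeff-shuffle-term r u q w))
     (sym (sh-addr (mono r u) (mono s v) (coeff q) w)))

coeff-ш : ∀ p q → coeff (p ш q) ≐ sh (coeff p) (coeff q)
coeff-ш [] q w = sym (sh-0l (coeff q) ≐-refl w)
coeff-ш ((r , u) ∷ p) q w =
  trans (coeff-++ (concatMap (λ { (s , v) → map (λ w → (r * s , w)) (shW u v) }) q) (p ш q) w)
   (trans (cong₂ _+_ (coeff-shuffle-term r u q w) (coeff-ш p q w))
     (sym (sh-addl (mono r u) (coeff p) (coeff q) w)))

mono-++ : ∀ u v → cat (mono 1ℚ u) (mono 1ℚ v) ≐ mono 1ℚ (u ++ v)
mono-++ [] v = ≐-trans (cat-cong mono-nil ≐-refl) (cat-1l (mono 1ℚ v))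
mono-++ (z ∷ u) v =
  ≐-trans (cat-cong (mono-cons 1ℚ z u) ≐-refl)
   (≐-trans (cat-pre z (mono 1ℚ u) (mono 1ℚ v))
    (≐-trans (pre-cong z (mono-++ u v)) (≐-sym (mono-cons 1ℚ z (u ++ v)))))

mono-++-scaled : ∀ r s u v → mono (r * s) (u ++ v) ≐ cat (mono r u) (mono s v)
mono-++-scaled r s u v w =
  trans (mono-as-scale (r * s) (u ++ v) w)
   (trans (cong ((r * s) *_) (sym (mono-++ u v w)))
    (trans (*-assoc r s _)
     (sym (trans (cat-cong (mono-as-scale r u) (mono-as-scale s v) w)
           (trans (cat-scalel r (mono 1ℚ u) (scaleˢ s (mono 1ℚ v)) w)
             (cong (r *_) (cat-scaler s (mono 1ℚ u) (mono 1ℚ v) w)))))))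

concatTerm : Poly → ℚ × Word → Poly
concatTerm q (r , u) = map (λ { (s , v) → (r * s , u ++ v) }) q

concatP : Poly → Poly → Poly
concatP p q = concatMap (concatTerm q) p

coeff-concatTerm : ∀ r u q → coeff (concatTerm q (r , u)) ≐ cat (mono r u) (coeff q)
coeff-concatTerm r u [] w = sym (cat-0r (mono r u) ≐-refl w)
coeff-concatTerm r u ((s , v) ∷ q) w =
  trans (cong₂ _+_ (mono-++-scaled r s u v w) (coeff-concatTerm r u q w))
        (sym (cat-addr (mono r u) (mono s v) (coeff q) w))

coeff-concatP : ∀ p q → coeff (concatP p q) ≐ cat (coeff p) (coeff q)
coeff-concatP [] q w = sym (cat-0l (coeff q) ≐-refl w)
coeff-concatP ((r , u) ∷ p) q w =
  trans (coeff-++ (concatTerm q (r , u)) (concatP p q) w)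
   (trans (cong₂ _+_ (coeff-concatTerm r u q w) (coeff-concatP p q w))
     (sym (cat-addl (mono r u) (coeff p) (coeff q) w)))

-- With m = bc + cb, a ⋆-product of blocks e, d
-- starting with d turns every "d ⋆ e" into the ordinary product a m, so the
-- products are the series
--   A k = (a m)ᵏ   and   B j = (a m)ʲ a (b + c).

data IsBC : Letter → Set where
  isb : IsBC b
  isc : IsBC c

bcCb : Series → Series
bcCb f = pre b (pre c f) ⊕ pre c (pre b f)

b+cˢ : Series
b+cˢ = pre b 1ˢ ⊕ pre c 1ˢ

A : ℕ → Series
A zero = 1ˢ
A (suc k) = pre a (bcCb (A k))

B : ℕ → Series
B zero = pre a b+cˢ
B (suc j) = pre a (bcCb (B j))

letterP : Letter → Poly
letterP e = word (e ∷ [])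

-- The polynomial d ⋆ e = a m.
abcPlusAcb : Poly
abcPlusAcb = (1ℚ , a ∷ b ∷ c ∷ []) ∷ (1ℚ , a ∷ c ∷ b ∷ []) ∷ []

endsIn-++ : ∀ z u y v → endsIn z (u ++ y ∷ v) ≡ endsIn z (y ∷ v)
endsIn-++ z [] y v = refl
endsIn-++ z (x ∷ []) y v = refl
endsIn-++ z (x ∷ x' ∷ u) y v = endsIn-++ z (x' ∷ u) y v

starW-ab : ∀ {e} → IsBC e → ∀ u → starW (u ++ a ∷ b ∷ []) (e ∷ []) ≡ u ++ a ∷ b ∷ c ∷ []
starW-ab isb u rewrite endsIn-++ b u a (b ∷ []) = LP.++-assoc u (a ∷ b ∷ []) (c ∷ [])
starW-ab isc u rewrite endsIn-++ c u a (b ∷ []) = LP.++-assoc u (a ∷ b ∷ []) (c ∷ [])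

starW-ac : ∀ {e} → IsBC e → ∀ u → starW (u ++ a ∷ c ∷ []) (e ∷ []) ≡ u ++ a ∷ c ∷ b ∷ []
starW-ac isb u rewrite endsIn-++ b u a (c ∷ []) = LP.++-assoc u (a ∷ c ∷ []) (b ∷ [])
starW-ac isc u rewrite endsIn-++ c u a (c ∷ []) = LP.++-assoc u (a ∷ c ∷ []) (b ∷ [])

concat-d-⋆-letter : ∀ {e} → IsBC e → ∀ Y → coeff (concatP Y d ⋆ letterP e) ≐ coeff (concatP Y abcPlusAcb)
concat-d-⋆-letter bc [] w = refl
concat-d-⋆-letter bc ((r , u) ∷ Y) w =
  cong₂ _+_ (mono-cong (*-identityʳ (r * 1ℚ)) (starW-ab bc u) w)
   (cong₂ _+_ (mono-cong (*-identityʳ (r * 1ℚ)) (starW-ac bc u) w) (concat-d-⋆-letter bc Y w))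

coeff-abcPlusAcb : coeff abcPlusAcb ≐ pre a (bcCb 1ˢ)
coeff-abcPlusAcb w =
  trans (cong₂ _+_ (mono-word (a ∷ b ∷ c ∷ []) w) (trans (+-identityʳ _) (mono-word (a ∷ c ∷ b ∷ []) w)))
        (pre-⊕ a (pre b (pre c 1ˢ)) (pre c (pre b 1ˢ)) w)

coeff-d : coeff d ≐ B 0
coeff-d w =
  trans (cong₂ _+_ (mono-word (a ∷ b ∷ []) w) (trans (+-identityʳ _) (mono-word (a ∷ c ∷ []) w)))
        (pre-⊕ a (pre b 1ˢ) (pre c 1ˢ) w)

cat-abcPlusAcb : ∀ g → cat (coeff abcPlusAcb) g ≐ pre a (bcCb g)
cat-abcPlusAcb g =
  ≐-trans (cat-cong coeff-abcPlusAcb ≐-refl)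
  (≐-trans (cat-pre a (bcCb 1ˢ) g)
  (pre-cong a (≐-trans (cat-addl (pre b (pre c 1ˢ)) (pre c (pre b 1ˢ)) g)
     (⊕-cong (≐-trans (cat-pre b _ g) (pre-cong b (≐-trans (cat-pre c _ g) (pre-cong c (cat-1l g)))))
             (≐-trans (cat-pre c _ g) (pre-cong c (≐-trans (cat-pre b _ g) (pre-cong b (cat-1l g)))))))))

coeff-letterP : ∀ e → coeff (letterP e) ≐ pre e 1ˢ
coeff-letterP e = ≐-trans (coeff-word (e ∷ [])) (mono-word (e ∷ []))

cat-letterP : ∀ e g → cat (coeff (letterP e)) g ≐ pre e g
cat-letterP e g =
  ≐-trans (cat-cong (coeff-letterP e) ≐-refl) (≐-trans (cat-pre e 1ˢ g) (pre-cong e (cat-1l g)))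

cat-𝟙 : ∀ g → cat (coeff 𝟙) g ≐ g
cat-𝟙 g = ≐-trans (cat-cong coeff-𝟙 ≐-refl) (cat-1l g)

absorb-d⋆e : ∀ {e} → IsBC e → ∀ Y G → cat (coeff (concatP Y d ⋆ letterP e)) G ≐ cat (coeff Y) (pre a (bcCb G))
absorb-d⋆e bc Y G =
  ≐-trans (cat-cong (concat-d-⋆-letter bc Y) ≐-refl)
  (≐-trans (cat-cong (coeff-concatP Y abcPlusAcb) ≐-refl)
  (≐-trans (cat-assoc (coeff Y) (coeff abcPlusAcb) G)
           (cat-cong ≐-refl (cat-abcPlusAcb G))))

ED : Letter → ℕ → List Poly
ED e zero = []
ED e (suc k) = letterP e ∷ d ∷ ED e k

DE : Letter → ℕ → List Poly
DE e zero = []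
DE e (suc k) = d ∷ letterP e ∷ DE e k

foldl-ED : ∀ {e} → IsBC e → ∀ m Y → coeff (foldl _⋆_ (concatP Y d) (ED e m)) ≐ cat (coeff Y) (B m)
foldl-ED bc zero Y = ≐-trans (coeff-concatP Y d) (cat-cong ≐-refl coeff-d)
foldl-ED {e} bc (suc m) Y = ≐-trans (foldl-ED bc m (concatP Y d ⋆ letterP e)) (absorb-d⋆e bc Y (B m))

foldl-DE : ∀ {e} → IsBC e → ∀ m Y → coeff (foldl _⋆_ (concatP Y d ⋆ letterP e) (DE e m)) ≐ cat (coeff Y) (A (suc m))
foldl-DE {e} bc zero Y = ≐-trans (≐-sym (cat-1r _)) (absorb-d⋆e bc Y 1ˢ)
foldl-DE {e} bc (suc m) Y = ≐-trans (foldl-DE bc m (concatP Y d ⋆ letterP e)) (absorb-d⋆e bc Y (A (suc m)))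

starProd-DE : ∀ {e} → IsBC e → ∀ k → coeff (starProd (DE e k)) ≐ A k
starProd-DE bc zero = coeff-𝟙
starProd-DE bc (suc k) = ≐-trans (foldl-DE bc k 𝟙) (cat-𝟙 _)

starProd-eDE : ∀ {e} → IsBC e → ∀ k → coeff (starProd (letterP e ∷ DE e k)) ≐ pre e (A k)
starProd-eDE {e} bc zero = coeff-letterP e
starProd-eDE {e} bc (suc k) = ≐-trans (foldl-DE bc k (letterP e)) (cat-letterP e _)

starProd-ED : ∀ {e} → IsBC e → ∀ j → coeff (starProd (ED e (suc j))) ≐ pre e (B j)
starProd-ED {e} bc j = ≐-trans (foldl-ED bc j (letterP e)) (cat-letterP e _)

starProd-dED : ∀ {e} → IsBC e → ∀ j → coeff (starProd (d ∷ ED e j)) ≐ B j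
starProd-dED bc j = ≐-trans (foldl-ED bc j 𝟙) (cat-𝟙 _)

-- Identifying the prefix products Pᵢ and suffix products Sᵢ.  The block list
-- is (e d)ⁿ; cutting it after 2k or 2k+1 blocks gives the four shapes above.

double : ℕ → ℕ
double zero = zero
double (suc k) = suc (suc (double k))

2*≡double : ∀ n → 2 ℕ.* n ≡ double n
2*≡double zero = refl
2*≡double (suc n) = cong suc (trans (NP.+-suc n (n ℕ.+ 0)) (cong suc (2*≡double n)))

if-false : ∀ {X : Set} {β} {x y : X} → β ≡ false → (if β then x else y) ≡ y
if-false refl = refl

if-true : ∀ {X : Set} {β} {x y : X} → β ≡ true → (if β then x else y) ≡ x
if-true refl = refl

isOdd-double : ∀ k → isOdd (double k) ≡ false
isOdd-double zero = refl
isOdd-double (suc k) = isOdd-double k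

isOdd-suc-double : ∀ k → isOdd (suc (double k)) ≡ true
isOdd-suc-double zero = refl
isOdd-suc-double (suc k) = isOdd-suc-double k

applyUpTo-ED : ∀ e n → applyUpTo (λ k → L e (suc k)) (double n) ≡ ED e n
applyUpTo-ED e zero = refl
applyUpTo-ED e (suc n) = cong (λ t → letterP e ∷ d ∷ t) (applyUpTo-ED e n)

blocks-ED : ∀ e n → blocks e n ≡ ED e n
blocks-ED e n =
  trans (LP.map-upTo (λ k → L e (suc k)) (2 ℕ.* n))
        (trans (cong (applyUpTo (λ k → L e (suc k))) (2*≡double n)) (applyUpTo-ED e n))

ED-++ : ∀ e k m → ED e (k ℕ.+ m) ≡ ED e k ++ ED e m
ED-++ e zero m = refl
ED-++ e (suc k) m = cong (λ t → letterP e ∷ d ∷ t) (ED-++ e k m)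

blocks-split : ∀ e {k n} → k ≤ n → blocks e n ≡ ED e k ++ ED e (n ∸ k)
blocks-split e {k} {n} k≤n =
  trans (blocks-ED e n) (trans (cong (ED e) (sym (NP.m+[n∸m]≡n k≤n))) (ED-++ e k (n ∸ k)))

blocks-split-suc : ∀ e {k N} → k ≤ N → blocks e (suc N) ≡ ED e k ++ ED e (suc (N ∸ k))
blocks-split-suc e {k} k≤N =
  trans (blocks-split e (NP.m≤n⇒m≤1+n k≤N)) (cong (λ m → ED e k ++ ED e m) (NP.+-∸-assoc 1 k≤N))

take-ED : ∀ e k X → take (double k) (ED e k ++ X) ≡ ED e k
take-ED e zero X = refl
take-ED e (suc k) X = cong (λ t → letterP e ∷ d ∷ t) (take-ED e k X)

drop-ED : ∀ e k X → drop (double k) (ED e k ++ X) ≡ X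
drop-ED e zero X = refl
drop-ED e (suc k) X = drop-ED e k X

take-ED-suc : ∀ e k R → take (suc (double k)) (ED e k ++ (letterP e ∷ R)) ≡ letterP e ∷ DE e k
take-ED-suc e zero R = refl
take-ED-suc e (suc k) R = cong (λ t → letterP e ∷ d ∷ t) (take-ED-suc e k R)

drop-ED-suc : ∀ e k R → drop (suc (double k)) (ED e k ++ (letterP e ∷ R)) ≡ R
drop-ED-suc e zero R = refl
drop-ED-suc e (suc k) R = drop-ED-suc e k R

DE-snoc : ∀ e k → DE e k ++ (d ∷ letterP e ∷ []) ≡ DE e (suc k)
DE-snoc e zero = refl
DE-snoc e (suc k) = cong (λ t → d ∷ letterP e ∷ t) (DE-snoc e k)

reverse-ED : ∀ e k → reverse (ED e k) ≡ DE e k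
reverse-ED e zero = refl
reverse-ED e (suc k) =
  trans (LP.reverse-++ (letterP e ∷ d ∷ []) (ED e k))
        (trans (cong (_++ (d ∷ letterP e ∷ [])) (reverse-ED e k)) (DE-snoc e k))

P-even : ∀ {e} → IsBC e → ∀ {k n} → k ≤ n → coeff (P e n (double k)) ≐ A k
P-even {e} bc {k} {n} k≤n = ≐-trans (coeff-≡ P≡) (starProd-DE bc k)
  where
  open ≡-Reasoning
  P≡ : P e n (double k) ≡ starProd (DE e k)
  P≡ = begin
    P e n (double k)                                      ≡⟨ if-false (isOdd-double k) ⟩
    starProd (reverse (take (double k) (blocks e n)))     ≡⟨ cong (λ l → starProd (reverse (take (double k) l))) (blocks-split e k≤n) ⟩
    starProd (reverse (take (double k) (ED e k ++ _)))    ≡⟨ cong (λ l → starProd (reverse l)) (take-ED e k _) ⟩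
    starProd (reverse (ED e k))                           ≡⟨ cong starProd (reverse-ED e k) ⟩
    starProd (DE e k)                                     ∎

S-even : ∀ {e} → IsBC e → ∀ {k N} → k ≤ N → coeff (S e (suc N) (double k)) ≐ pre e (B (N ∸ k))
S-even {e} bc {k} {N} k≤N = ≐-trans (coeff-≡ S≡) (starProd-ED bc (N ∸ k))
  where
  open ≡-Reasoning
  S≡ : S e (suc N) (double k) ≡ starProd (ED e (suc (N ∸ k)))
  S≡ = begin
    starProd (drop (double k) (blocks e (suc N)))  ≡⟨ cong (λ l → starProd (drop (double k) l)) (blocks-split-suc e k≤N) ⟩
    starProd (drop (double k) (ED e k ++ _))       ≡⟨ cong starProd (drop-ED e k _) ⟩
    starProd (ED e (suc (N ∸ k)))                  ∎

S-last : ∀ e n → coeff (S e n (double n)) ≐ 1ˢ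
S-last e n = ≐-trans (coeff-≡ S≡) coeff-𝟙
  where
  open ≡-Reasoning
  S≡ : S e n (double n) ≡ 𝟙
  S≡ = begin
    starProd (drop (double n) (blocks e n))         ≡⟨ cong (λ l → starProd (drop (double n) l)) (blocks-split e (NP.≤-refl {n})) ⟩
    starProd (drop (double n) (ED e n ++ ED e (n ∸ n))) ≡⟨ cong starProd (drop-ED e n _) ⟩
    starProd (ED e (n ∸ n))                         ≡⟨ cong (λ m → starProd (ED e m)) (NP.n∸n≡0 n) ⟩
    𝟙                                               ∎

P-odd : ∀ {e} → IsBC e → ∀ {k N} → k ≤ N → coeff (P e (suc N) (suc (double k))) ≐ pre e (A k)
P-odd {e} bc {k} {N} k≤N = ≐-trans (coeff-≡ P≡) (starProd-eDE bc k)
  where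
  open ≡-Reasoning
  P≡ : P e (suc N) (suc (double k)) ≡ starProd (letterP e ∷ DE e k)
  P≡ = begin
    P e (suc N) (suc (double k))                        ≡⟨ if-true (isOdd-suc-double k) ⟩
    starProd (take (suc (double k)) (blocks e (suc N))) ≡⟨ cong (λ l → starProd (take (suc (double k)) l)) (blocks-split-suc e k≤N) ⟩
    starProd (take (suc (double k)) (ED e k ++ _))      ≡⟨ cong starProd (take-ED-suc e k _) ⟩
    starProd (letterP e ∷ DE e k)                       ∎

S-odd : ∀ {e} → IsBC e → ∀ {k N} → k ≤ N → coeff (S e (suc N) (suc (double k))) ≐ B (N ∸ k)
S-odd {e} bc {k} {N} k≤N = ≐-trans (coeff-≡ S≡) (starProd-dED bc (N ∸ k))
  where
  open ≡-Reasoning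
  S≡ : S e (suc N) (suc (double k)) ≡ starProd (d ∷ ED e (N ∸ k))
  S≡ = begin
    starProd (drop (suc (double k)) (blocks e (suc N))) ≡⟨ cong (λ l → starProd (drop (suc (double k)) l)) (blocks-split-suc e k≤N) ⟩
    starProd (drop (suc (double k)) (ED e k ++ _))      ≡⟨ cong starProd (drop-ED-suc e k _) ⟩
    starProd (d ∷ ED e (N ∸ k))                         ∎

sumQ : (ℕ → ℚ) → ℕ → ℚ
sumQ g zero = 0ℚ
sumQ g (suc n) = g 0 + sumQ (λ k → g (suc k)) n

sumQ-cong< : ∀ {f g} n → (∀ k → k < n → f k ≡ g k) → sumQ f n ≡ sumQ g n
sumQ-cong< zero e = refl
sumQ-cong< (suc n) e = cong₂ _+_ (e 0 (s≤s z≤n)) (sumQ-cong< n (λ k k<n → e (suc k) (s≤s k<n)))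

sumQ-cong : ∀ {f g} n → (∀ k → f k ≡ g k) → sumQ f n ≡ sumQ g n
sumQ-cong n e = sumQ-cong< n (λ k _ → e k)

sumQ-add : ∀ f g n → sumQ (λ k → f k + g k) n ≡ sumQ f n + sumQ g n
sumQ-add f g zero = sym (+-identityʳ 0ℚ)
sumQ-add f g (suc n) =
  trans (cong (f 0 + g 0 +_) (sumQ-add (λ k → f (suc k)) (λ k → g (suc k)) n))
        (interchange (f 0) (g 0) (sumQ (λ k → f (suc k)) n) (sumQ (λ k → g (suc k)) n))

sumQ-scale : ∀ r f n → sumQ (λ k → r * f k) n ≡ r * sumQ f n
sumQ-scale r f zero = sym (*-zeroʳ r)
sumQ-scale r f (suc n) =
  trans (cong (r * f 0 +_) (sumQ-scale r (λ k → f (suc k)) n)) (sym (*-distribˡ-+ r _ _))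

sumQ-0 : ∀ f n → (∀ k → f k ≡ 0ℚ) → sumQ f n ≡ 0ℚ
sumQ-0 f zero e = refl
sumQ-0 f (suc n) e = trans (cong₂ _+_ (e 0) (sumQ-0 (λ k → f (suc k)) n (λ k → e (suc k)))) (+-identityʳ 0ℚ)

sumQ-last : ∀ g m → sumQ g (suc m) ≡ sumQ g m + g m
sumQ-last g zero = trans (+-identityʳ (g 0)) (sym (+-identityˡ (g 0)))
sumQ-last g (suc m) =
  trans (cong (g 0 +_) (sumQ-last (λ k → g (suc k)) m)) (sym (+-assoc (g 0) _ _))

sumQ-pairs : ∀ g m → sumQ g (double m) ≡ sumQ (λ k → g (double k) + g (suc (double k))) m
sumQ-pairs g zero = refl
sumQ-pairs g (suc m) =
  trans (cong (λ t → g 0 + (g 1 + t)) (sumQ-pairs (λ k → g (suc (suc k))) m))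
        (sym (+-assoc (g 0) (g 1) _))

coeff-sumP : ∀ (Fp : ℕ → Poly) g m w →
  coeff (foldr _+P_ [] (map Fp (applyUpTo g m))) w ≡ sumQ (λ i → coeff (Fp (g i)) w) m
coeff-sumP Fp g zero w = refl
coeff-sumP Fp g (suc m) w =
  trans (coeff-++ (Fp (g 0)) _ w) (cong (coeff (Fp (g 0)) w +_) (coeff-sumP Fp (λ k → g (suc k)) m w))

-- conv F N collects the terms F k j with k + j = N - 1.
conv : (ℕ → ℕ → Series) → ℕ → Series
conv F N w = sumQ (λ k → F k (N ∸ suc k) w) N

conv-cong : ∀ {F G} N → (∀ k j → F k j ≐ G k j) → conv F N ≐ conv G N
conv-cong N e w = sumQ-cong N (λ k → e k _ w)

conv-0-at : ∀ F N w → (∀ k j → F k j w ≡ 0ℚ) → conv F N w ≡ 0ℚ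
conv-0-at F N w e = sumQ-0 _ N (λ k → e k _)

conv-0 : ∀ F N → (∀ k j → F k j ≐ 0ˢ) → conv F N ≐ 0ˢ
conv-0 F N e w = conv-0-at F N w (λ k j → e k j w)

conv-add : ∀ F G N → conv (λ k j → F k j ⊕ G k j) N ≐ conv F N ⊕ conv G N
conv-add F G N w = sumQ-add _ _ N

conv-scale : ∀ r F N → conv (λ k j → scaleˢ r (F k j)) N ≐ scaleˢ r (conv F N)
conv-scale r F N w = sumQ-scale r _ N

conv-last : ∀ M G → conv G (suc M) ≐ conv (λ k j → G k (suc j)) M ⊕ G M 0
conv-last zero G w = trans (+-identityʳ (G 0 0 w)) (sym (+-identityˡ (G 0 0 w)))
conv-last (suc M) G w =
  trans (cong (G 0 (suc M) w +_) (conv-last M (λ k j → G (suc k) j) w))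
        (sym (+-assoc (G 0 (suc M) w) (conv (λ k j → G (suc k) (suc j)) M w) (G (suc M) 0 w)))

neg1 : ℚ
neg1 = - 1ℚ

neg2 : ℚ
neg2 = - (1ℚ + 1ℚ)

Tterm : Letter → ℕ → ℕ → Series
Tterm x k j = sh (A k) (pre x (B j)) ⊕ scaleˢ neg1 (sh (pre x (A k)) (B j))

T : Letter → ℕ → Series
T x N = sh (A N) 1ˢ ⊕ conv (Tterm x) N

term : Letter → ℕ → Word → ℕ → ℚ
term e n w i = coeff (scale (signQ i) (P e n i ш S e n i)) w

term-as-sh : ∀ e n w i → term e n w i ≡ signQ i * sh (coeff (P e n i)) (coeff (S e n i)) w
term-as-sh e n w i = trans (coeff-scale (signQ i) (P e n i ш S e n i) w) (cong (signQ i *_) (coeff-ш (P e n i) (S e n i) w))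

term-even : ∀ {e} → IsBC e → ∀ {k N} w → k ≤ N → term e (suc N) w (double k) ≡ sh (A k) (pre e (B (N ∸ k))) w
term-even {e} bc {k} {N} w k≤N =
  trans (term-as-sh e (suc N) w (double k))
   (trans (cong₂ _*_ (if-false (isOdd-double k)) (sh-cong (P-even bc (NP.m≤n⇒m≤1+n k≤N)) (S-even bc k≤N) w))
          (*-identityˡ _))

term-odd : ∀ {e} → IsBC e → ∀ {k N} w → k ≤ N → term e (suc N) w (suc (double k)) ≡ neg1 * sh (pre e (A k)) (B (N ∸ k)) w
term-odd {e} bc {k} {N} w k≤N =
  trans (term-as-sh e (suc N) w (suc (double k)))
        (cong₂ _*_ (if-true (isOdd-suc-double k)) (sh-cong (P-odd bc k≤N) (S-odd bc k≤N) w))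

term-last : ∀ {e} → IsBC e → ∀ n w → term e n w (double n) ≡ sh (A n) 1ˢ w
term-last {e} bc n w =
  trans (term-as-sh e n w (double n))
   (trans (cong₂ _*_ (if-false (isOdd-double n)) (sh-cong (P-even bc (NP.≤-refl {n})) (S-last e n) w))
          (*-identityˡ _))

-- The left-hand side is T e n: group the summands in pairs (2k, 2k+1) and
-- split off the last one.
LHS≐T : ∀ {e} → IsBC e → ∀ N → coeff (LHS e (suc N)) ≐ T e (suc N)
LHS≐T {e} bc N w = begin
  coeff (LHS e n) w
    ≡⟨ coeff-sumP (λ i → scale (signQ i) (P e n i ш S e n i)) (λ i → i) (suc (2 ℕ.* n)) w ⟩
  sumQ (term e n w) (suc (2 ℕ.* n))
    ≡⟨ cong (λ m → sumQ (term e n w) (suc m)) (2*≡double n) ⟩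
  sumQ (term e n w) (suc (double n))
    ≡⟨ sumQ-last (term e n w) (double n) ⟩
  sumQ (term e n w) (double n) + term e n w (double n)
    ≡⟨ cong₂ _+_ (trans (sumQ-pairs (term e n w) n) (sumQ-cong< n pair)) (term-last bc n w) ⟩
  conv (Tterm e) n w + sh (A n) 1ˢ w
    ≡⟨ +-comm (conv (Tterm e) n w) (sh (A n) 1ˢ w) ⟩
  T e n w ∎
  where
  open ≡-Reasoning
  n : ℕ
  n = suc N
  pair : ∀ k → k < n → term e n w (double k) + term e n w (suc (double k)) ≡ Tterm e k (N ∸ k) w
  pair k (s≤s k≤N) = cong₂ _+_ (term-even bc w k≤N) (term-odd bc w k≤N)

data BCPair : Letter → Letter → Set where
  pbc : BCPair b c
  pcb : BCPair c b

BCPair-sym : ∀ {x y} → BCPair x y → BCPair y x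
BCPair-sym pbc = pcb
BCPair-sym pcb = pbc

series-ext : ∀ {x y} → BCPair x y → ∀ {f g} →
  f [] ≡ g [] → δ a f ≐ δ a g → δ x f ≐ δ x g → δ y f ≐ δ y g → f ≐ g
series-ext p e0 ea ex ey [] = e0
series-ext p e0 ea ex ey (a ∷ w) = ea w
series-ext pbc e0 ea ex ey (b ∷ w) = ex w
series-ext pbc e0 ea ex ey (c ∷ w) = ey w
series-ext pcb e0 ea ex ey (b ∷ w) = ey w
series-ext pcb e0 ea ex ey (c ∷ w) = ex w

sum-0 : ∀ {u v} → u ≡ 0ℚ → v ≡ 0ℚ → u + v ≡ 0ℚ
sum-0 refl refl = refl

⊕-0 : ∀ {f g} → f ≐ 0ˢ → g ≐ 0ˢ → f ⊕ g ≐ 0ˢ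
⊕-0 p q w = sum-0 (p w) (q w)

difference-0 : ∀ {u v} → u ≡ 0ℚ → v ≡ 0ℚ → u + neg1 * v ≡ 0ℚ
difference-0 refl refl = refl

scaleˢ-vanish : ∀ r {f} → f ≐ 0ˢ → scaleˢ r f ≐ 0ˢ
scaleˢ-vanish r p w = trans (cong (r *_) (p w)) (*-zeroʳ r)

⊕-neg-cancel : ∀ f → f ⊕ scaleˢ neg1 f ≐ 0ˢ
⊕-neg-cancel f w = solve 1 (λ s → s :+ con neg1 :* s := con 0ℚ) refl (f w)

δ-sh : ∀ z {f g f' g'} → δ z f ≐ f' → δ z g ≐ g' → δ z (sh f g) ≐ sh f' g ⊕ sh f g'
δ-sh z p q w = cong₂ _+_ (sh-cong p ≐-refl w) (sh-cong ≐-refl q w)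

δ-sh-left : ∀ z {f g f'} → δ z f ≐ f' → δ z g ≐ 0ˢ → δ z (sh f g) ≐ sh f' g
δ-sh-left z {f} {g} {f'} p q w =
  trans (δ-sh z p q w) (trans (cong (sh f' g w +_) (sh-0r f ≐-refl w)) (+-identityʳ _))

δ-sh-right : ∀ z {f g g'} → δ z f ≐ 0ˢ → δ z g ≐ g' → δ z (sh f g) ≐ sh f g'
δ-sh-right z {f} {g} {g'} p q w =
  trans (δ-sh z p q w) (trans (cong (_+ sh f g' w) (sh-0l g ≐-refl w)) (+-identityˡ _))

δ-sh-0 : ∀ z {f g} → δ z f ≐ 0ˢ → δ z g ≐ 0ˢ → δ z (sh f g) ≐ 0ˢ
δ-sh-0 z {f} {g} p q = ≐-trans (δ-sh-left z p q) (sh-0l g ≐-refl)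

sh-ε-0ˡ : ∀ f g → f [] ≡ 0ℚ → sh f g [] ≡ 0ℚ
sh-ε-0ˡ f g e = trans (cong (_* g []) e) (*-zeroˡ (g []))

sh-ε-0ʳ : ∀ f g → g [] ≡ 0ℚ → sh f g [] ≡ 0ℚ
sh-ε-0ʳ f g e = trans (cong (f [] *_) e) (*-zeroʳ (f []))

δ-pre-self : ∀ z f → δ z (pre z f) ≐ f
δ-pre-self a f w = refl
δ-pre-self b f w = refl
δ-pre-self c f w = refl

δ-pre-other : ∀ {x y} → BCPair x y → ∀ f → δ x (pre y f) ≐ 0ˢ
δ-pre-other pbc f w = refl
δ-pre-other pcb f w = refl

δa-pre : ∀ {x y} → BCPair x y → ∀ f → δ a (pre x f) ≐ 0ˢ
δa-pre pbc f w = refl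
δa-pre pcb f w = refl

δ-pre-a : ∀ {x y} → BCPair x y → ∀ f → δ x (pre a f) ≐ 0ˢ
δ-pre-a pbc f w = refl
δ-pre-a pcb f w = refl

δ-bcCb : ∀ {x y} → BCPair x y → ∀ f → δ x (bcCb f) ≐ pre y f
δ-bcCb pbc f w = +-identityʳ _
δ-bcCb pcb f w = +-identityˡ _

δa-bcCb : ∀ f → δ a (bcCb f) ≐ 0ˢ
δa-bcCb f w = +-identityʳ 0ℚ

δ-b+c : ∀ {x y} → BCPair x y → δ x b+cˢ ≐ 1ˢ
δ-b+c pbc w = +-identityʳ _
δ-b+c pcb w = +-identityˡ _

-- The derivatives of A and B.  A′ = δ_a A and B′ = δ_a B; δ_x A′ and δ_x B′
-- are x·A_{k-1} and x·B_{j-1} (with the conventions 0 and 1 for k, j = 0).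

A′ : ℕ → Series
A′ zero = 0ˢ
A′ (suc k) = bcCb (A k)

B′ : ℕ → Series
B′ zero = b+cˢ
B′ (suc j) = bcCb (B j)

xA₋ : Letter → ℕ → Series
xA₋ l zero = 0ˢ
xA₋ l (suc k) = pre l (A k)

xB₋ : Letter → ℕ → Series
xB₋ l zero = 1ˢ
xB₋ l (suc j) = pre l (B j)

A₋ : ℕ → Series
A₋ zero = 0ˢ
A₋ (suc k) = A k

B₋ : ℕ → Series
B₋ zero = 0ˢ
B₋ (suc j) = B j

δa-A : ∀ k → δ a (A k) ≐ A′ k
δa-A zero w = refl
δa-A (suc k) w = refl

δa-B : ∀ k → δ a (B k) ≐ B′ k
δa-B zero w = refl
δa-B (suc k) w = refl

δ-A : ∀ {x y} → BCPair x y → ∀ k → δ x (A k) ≐ 0ˢ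
δ-A p zero w = refl
δ-A p (suc k) = δ-pre-a p _

δ-B : ∀ {x y} → BCPair x y → ∀ k → δ x (B k) ≐ 0ˢ
δ-B p zero = δ-pre-a p _
δ-B p (suc k) = δ-pre-a p _

δa-A′ : ∀ k → δ a (A′ k) ≐ 0ˢ
δa-A′ zero w = refl
δa-A′ (suc k) = δa-bcCb (A k)

δa-B′ : ∀ k → δ a (B′ k) ≐ 0ˢ
δa-B′ zero w = +-identityʳ 0ℚ
δa-B′ (suc k) = δa-bcCb (B k)

δ-A′ : ∀ {x y} → BCPair x y → ∀ k → δ x (A′ k) ≐ xA₋ y k
δ-A′ p zero w = refl
δ-A′ p (suc k) = δ-bcCb p _

δ-B′ : ∀ {x y} → BCPair x y → ∀ k → δ x (B′ k) ≐ xB₋ y k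
δ-B′ p zero = δ-b+c p
δ-B′ p (suc k) = δ-bcCb p _

δ-xA₋-self : ∀ l k → δ l (xA₋ l k) ≐ A₋ k
δ-xA₋-self l zero w = refl
δ-xA₋-self l (suc k) = δ-pre-self l _

δ-xA₋-other : ∀ {x y} → BCPair x y → ∀ k → δ x (xA₋ y k) ≐ 0ˢ
δ-xA₋-other p zero w = refl
δ-xA₋-other p (suc k) = δ-pre-other p _

δa-xA₋ : ∀ {x y} → BCPair x y → ∀ k → δ a (xA₋ x k) ≐ 0ˢ
δa-xA₋ p zero w = refl
δa-xA₋ p (suc k) = δa-pre p _

δ-xB₋-self : ∀ l k → δ l (xB₋ l k) ≐ B₋ k
δ-xB₋-self l zero w = refl
δ-xB₋-self l (suc k) = δ-pre-self l _

δ-xB₋-other : ∀ {x y} → BCPair x y → ∀ k → δ x (xB₋ y k) ≐ 0ˢ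
δ-xB₋-other p zero w = refl
δ-xB₋-other p (suc k) = δ-pre-other p _

δa-xB₋ : ∀ {x y} → BCPair x y → ∀ k → δ a (xB₋ x k) ≐ 0ˢ
δa-xB₋ p zero w = refl
δa-xB₋ p (suc k) = δa-pre p _

A′-ε : ∀ k → A′ k [] ≡ 0ℚ
A′-ε zero = refl
A′-ε (suc k) = +-identityʳ 0ℚ

B-ε : ∀ j → B j [] ≡ 0ℚ
B-ε zero = refl
B-ε (suc j) = refl

B′-ε : ∀ j → B′ j [] ≡ 0ℚ
B′-ε zero = +-identityʳ 0ℚ
B′-ε (suc j) = +-identityʳ 0ℚ

conv-shift-first : ∀ M {G Q} → (∀ j → G 0 j ≐ 0ˢ) → (∀ k j → G (suc k) j ≐ Q k j) → conv G (suc M) ≐ conv Q M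
conv-shift-first M h0 h1 w = trans (cong₂ _+_ (h0 M w) (conv-cong M h1 w)) (+-identityˡ _)

conv-shift-second : ∀ M {G Q} → (∀ k j → G k (suc j) ≐ Q k j) → conv G (suc M) ≐ conv Q M ⊕ G M 0
conv-shift-second M {G} h = ≐-trans (conv-last M G) (⊕-cong (conv-cong M h) ≐-refl)

telescope : ∀ M (G₁ G₂ Q : ℕ → ℕ → Series) (E : Series) →
  (∀ j → G₁ 0 j ≐ 0ˢ) → (∀ k j → G₁ (suc k) j ≐ Q k j) →
  (∀ k j → G₂ k (suc j) ≐ Q k j) → G₂ M 0 ≐ E →
  E ⊕ conv (λ k j → G₁ k j ⊕ scaleˢ neg1 (G₂ k j)) (suc M) ≐ 0ˢ
telescope M G₁ G₂ Q E h0 h1 h2 h3 w =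
  trans (cong (E w +_) (trans (conv-add G₁ (λ k j → scaleˢ neg1 (G₂ k j)) (suc M) w)
                         (cong₂ _+_ sum₁ (trans (conv-scale neg1 G₂ (suc M) w) (cong (neg1 *_) sum₂)))))
        (solve 2 (λ e q → e :+ (q :+ con neg1 :* (q :+ e)) := con 0ℚ) refl (E w) (conv Q M w))
  where
  sum₁ : conv G₁ (suc M) w ≡ conv Q M w
  sum₁ = conv-shift-first M {G₁} h0 h1 w
  sum₂ : conv G₂ (suc M) w ≡ conv Q M w + E w
  sum₂ = trans (conv-shift-second M {G₂} h2 w) (cong (conv Q M w +_) (h3 w))

telescope-doubled : ∀ M (Gₛ Gₜ Qₛ Qₜ : ℕ → ℕ → Series) (E : Series) →
  (∀ j → Gₛ 0 j ≐ 0ˢ) → (∀ k j → Gₛ (suc k) j ≐ Qₛ k j) →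
  (∀ k j → Gₜ k (suc j) ≐ Qₜ k j) → Gₜ M 0 ≐ E →
  conv (λ k j → (Gₛ k j ⊕ Gₛ k j) ⊕ scaleˢ neg1 (Gₜ k j ⊕ Gₜ k j)) (suc M)
    ≐ scaleˢ neg2 (E ⊕ conv (λ k j → Qₜ k j ⊕ scaleˢ neg1 (Qₛ k j)) M)
telescope-doubled M Gₛ Gₜ Qₛ Qₜ E h0 h1 h2 h3 w =
  trans (conv-add (λ k j → Gₛ k j ⊕ Gₛ k j) (λ k j → scaleˢ neg1 (Gₜ k j ⊕ Gₜ k j)) (suc M) w)
   (trans (cong₂ _+_ (trans (conv-add Gₛ Gₛ (suc M) w) (cong₂ _+_ sumₛ sumₛ))
                     (trans (conv-scale neg1 (λ k j → Gₜ k j ⊕ Gₜ k j) (suc M) w)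
                        (cong (neg1 *_) (trans (conv-add Gₜ Gₜ (suc M) w) (cong₂ _+_ sumₜ sumₜ)))))
     (trans (solve 3 (λ e qs qt → (qs :+ qs) :+ con neg1 :* ((qt :+ e) :+ (qt :+ e))
                          := con neg2 :* (e :+ (qt :+ con neg1 :* qs))) refl (E w) (conv Qₛ M w) (conv Qₜ M w))
            (cong (λ t → neg2 * (E w + t)) (sym (trans (conv-add Qₜ (λ k j → scaleˢ neg1 (Qₛ k j)) M w)
                                                  (cong (conv Qₜ M w +_) (conv-scale neg1 Qₛ M w)))))))
  where
  sumₛ : conv Gₛ (suc M) w ≡ conv Qₛ M w
  sumₛ = conv-shift-first M {Gₛ} h0 h1 w
  sumₜ : conv Gₜ (suc M) w ≡ conv Qₜ M w + E w
  sumₜ = trans (conv-shift-second M {Gₜ} h2 w) (cong (conv Qₜ M w +_) (h3 w))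

-- The auxiliary series U x M = δ_a (T x (M+1)) and V x y M = δ_x (U x M).

Uterm : Letter → ℕ → ℕ → Series
Uterm x k j = sh (A′ k) (pre x (B j)) ⊕ scaleˢ neg1 (sh (pre x (A k)) (B′ j))

U : Letter → ℕ → Series
U x M = sh (A′ (suc M)) 1ˢ ⊕ conv (Uterm x) (suc M)

Vterm : Letter → Letter → ℕ → ℕ → Series
Vterm x y k j = (sh (xA₋ y k) (pre x (B j)) ⊕ sh (A′ k) (B j))
              ⊕ scaleˢ neg1 (sh (A k) (B′ j) ⊕ sh (pre x (A k)) (xB₋ y j))

V : Letter → Letter → ℕ → Series
V x y M = sh (pre y (A M)) 1ˢ ⊕ conv (Vterm x y) (suc M)

T-ε : ∀ x M → T x (suc M) [] ≡ 0ℚ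
T-ε x M = trans (cong₂ _+_ (sh-ε-0ˡ (A (suc M)) 1ˢ refl) (conv-0-at (Tterm x) (suc M) [] termwise)) (+-identityʳ 0ℚ)
  where
  termwise : ∀ k j → Tterm x k j [] ≡ 0ℚ
  termwise k j = difference-0 (sh-ε-0ʳ (A k) (pre x (B j)) refl) (sh-ε-0ˡ (pre x (A k)) (B j) refl)

T-a : ∀ {x y} → BCPair x y → ∀ M → δ a (T x (suc M)) ≐ U x M
T-a {x} p M = ⊕-cong (δ-sh-left a ≐-refl (δ-1ˢ a)) (conv-cong (suc M) termwise)
  where
  termwise : ∀ k j → δ a (Tterm x k j) ≐ Uterm x k j
  termwise k j = ⊕-cong (δ-sh-left a (δa-A k) (δa-pre p _))
                        (scaleˢ-cong neg1 (δ-sh-right a (δa-pre p _) (δa-B j)))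

T-x : ∀ {x y} → BCPair x y → ∀ M → δ x (T x (suc M)) ≐ 0ˢ
T-x {x} p M = ⊕-0 (δ-sh-0 x (δ-A p (suc M)) (δ-1ˢ x)) (conv-0 _ (suc M) termwise)
  where
  termwise : ∀ k j → δ x (Tterm x k j) ≐ 0ˢ
  termwise k j = ≐-trans (⊕-cong (δ-sh-right x (δ-A p k) (δ-pre-self x _))
                                 (scaleˢ-cong neg1 (δ-sh-left x (δ-pre-self x _) (δ-B p j))))
                         (⊕-neg-cancel (sh (A k) (B j)))

T-y : ∀ {x y} → BCPair x y → ∀ M → δ y (T x (suc M)) ≐ 0ˢ
T-y {x} {y} p M = ⊕-0 (δ-sh-0 y (δ-A p̄ (suc M)) (δ-1ˢ y)) (conv-0 _ (suc M) termwise)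
  where
  p̄ : BCPair y x
  p̄ = BCPair-sym p
  termwise : ∀ k j → δ y (Tterm x k j) ≐ 0ˢ
  termwise k j = ⊕-0 (δ-sh-0 y (δ-A p̄ k) (δ-pre-other p̄ _))
                     (scaleˢ-vanish neg1 (δ-sh-0 y (δ-pre-other p̄ _) (δ-B p̄ j)))

U-ε : ∀ x M → U x M [] ≡ 0ℚ
U-ε x M = sum-0 (sh-ε-0ˡ (A′ (suc M)) 1ˢ (A′-ε (suc M))) (conv-0-at (Uterm x) (suc M) [] termwise)
  where
  termwise : ∀ k j → Uterm x k j [] ≡ 0ℚ
  termwise k j = difference-0 (sh-ε-0ʳ (A′ k) (pre x (B j)) refl) (sh-ε-0ˡ (pre x (A k)) (B′ j) refl)

U-a : ∀ {x y} → BCPair x y → ∀ M → δ a (U x M) ≐ 0ˢ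
U-a {x} p M = ⊕-0 (δ-sh-0 a (δa-A′ (suc M)) (δ-1ˢ a)) (conv-0 _ (suc M) termwise)
  where
  termwise : ∀ k j → δ a (Uterm x k j) ≐ 0ˢ
  termwise k j = ⊕-0 (δ-sh-0 a (δa-A′ k) (δa-pre p _))
                     (scaleˢ-vanish neg1 (δ-sh-0 a (δa-pre p _) (δa-B′ j)))

U-x : ∀ {x y} → BCPair x y → ∀ M → δ x (U x M) ≐ V x y M
U-x {x} {y} p M = ⊕-cong (δ-sh-left x (δ-A′ p (suc M)) (δ-1ˢ x)) (conv-cong (suc M) termwise)
  where
  termwise : ∀ k j → δ x (Uterm x k j) ≐ Vterm x y k j
  termwise k j = ⊕-cong (δ-sh x (δ-A′ p k) (δ-pre-self x _))
                        (scaleˢ-cong neg1 (δ-sh x (δ-pre-self x _) (δ-B′ p j)))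

U-y : ∀ {x y} → BCPair x y → ∀ M → δ y (U x M) ≐ 0ˢ
U-y {x} {y} p M =
  ≐-trans (⊕-cong (δ-sh-left y (δ-A′ p̄ (suc M)) (δ-1ˢ y)) (conv-cong (suc M) termwise))
          (telescope M G₁ G₂ (λ k j → sh (pre x (A k)) (pre x (B j))) (sh (pre x (A M)) 1ˢ)
                     (λ j → sh-0l _ ≐-refl) (λ k j → ≐-refl) (λ k j → ≐-refl) ≐-refl)
  where
  p̄ : BCPair y x
  p̄ = BCPair-sym p
  G₁ G₂ : ℕ → ℕ → Series
  G₁ k j = sh (xA₋ x k) (pre x (B j))
  G₂ k j = sh (pre x (A k)) (xB₋ x j)
  termwise : ∀ k j → δ y (Uterm x k j) ≐ G₁ k j ⊕ scaleˢ neg1 (G₂ k j)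
  termwise k j = ⊕-cong (δ-sh-left y (δ-A′ p̄ k) (δ-pre-other p̄ _))
                        (scaleˢ-cong neg1 (δ-sh-right y (δ-pre-other p̄ _) (δ-B′ p̄ j)))

V-ε : ∀ x y M → V x y M [] ≡ 0ℚ
V-ε x y M = sum-0 (sh-ε-0ˡ (pre y (A M)) 1ˢ refl) (conv-0-at (Vterm x y) (suc M) [] termwise)
  where
  termwise : ∀ k j → Vterm x y k j [] ≡ 0ℚ
  termwise k j = difference-0 (sum-0 (sh-ε-0ʳ (xA₋ y k) (pre x (B j)) refl) (sh-ε-0ʳ (A′ k) (B j) (B-ε j)))
                              (sum-0 (sh-ε-0ʳ (A k) (B′ j) (B′-ε j)) (sh-ε-0ˡ (pre x (A k)) (xB₋ y j) refl))

V-a : ∀ {x y} → BCPair x y → ∀ M → δ a (V x y M) ≐ 0ˢ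
V-a {x} {y} p M = ⊕-0 (δ-sh-0 a (δa-pre p̄ _) (δ-1ˢ a)) (conv-0 _ (suc M) termwise)
  where
  p̄ : BCPair y x
  p̄ = BCPair-sym p
  cancel : ∀ s → (0ℚ + s) + neg1 * (s + 0ℚ) ≡ 0ℚ
  cancel = solve 1 (λ s → (con 0ℚ :+ s) :+ con neg1 :* (s :+ con 0ℚ) := con 0ℚ) refl
  termwise : ∀ k j → δ a (Vterm x y k j) ≐ 0ˢ
  termwise k j w =
    trans (cong₂ _+_ (cong₂ _+_ (δ-sh-0 a (δa-xA₋ p̄ k) (δa-pre p _) w) (δ-sh-right a (δa-A′ k) (δa-B j) w))
                     (cong (neg1 *_) (cong₂ _+_ (δ-sh-left a (δa-A k) (δa-B′ j) w) (δ-sh-0 a (δa-pre p _) (δa-xB₋ p̄ j) w))))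
          (cancel (sh (A′ k) (B′ j) w))

V-y : ∀ {x y} → BCPair x y → ∀ M → δ y (V x y M) ≐ 0ˢ
V-y {x} {y} p M =
  ≐-trans (⊕-cong (δ-sh-left y (δ-pre-self y _) (δ-1ˢ y)) (conv-cong (suc M) termwise))
          (telescope M G₁ G₂ (λ k j → sh (A k) (pre x (B j)) ⊕ sh (pre x (A k)) (B j)) (sh (A M) 1ˢ)
                     (λ j → ⊕-0 (sh-0l _ ≐-refl) (sh-0l _ ≐-refl)) (λ k j → ≐-refl) (λ k j → ≐-refl)
                     (λ w → trans (cong (sh (A M) 1ˢ w +_) (sh-0r _ ≐-refl w)) (+-identityʳ _)))
  where
  p̄ : BCPair y x
  p̄ = BCPair-sym p
  G₁ G₂ : ℕ → ℕ → Series
  G₁ k j = sh (A₋ k) (pre x (B j)) ⊕ sh (xA₋ x k) (B j)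
  G₂ k j = sh (A k) (xB₋ x j) ⊕ sh (pre x (A k)) (B₋ j)
  termwise : ∀ k j → δ y (Vterm x y k j) ≐ G₁ k j ⊕ scaleˢ neg1 (G₂ k j)
  termwise k j = ⊕-cong (⊕-cong (δ-sh-left y (δ-xA₋-self y k) (δ-pre-other p̄ _)) (δ-sh-left y (δ-A′ p̄ k) (δ-B p̄ j)))
                        (scaleˢ-cong neg1 (⊕-cong (δ-sh-right y (δ-A p̄ k) (δ-B′ p̄ j))
                                                  (δ-sh-right y (δ-pre-other p̄ _) (δ-xB₋-self y j))))

V-x : ∀ {x y} → BCPair x y → ∀ M → δ x (V x y M) ≐ scaleˢ neg2 (T y M)
V-x {x} {y} p M w =
  trans (cong₂ _+_ (δ-sh-0 x (δ-pre-other p _) (δ-1ˢ x) w) (conv-cong (suc M) termwise w))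
   (trans (+-identityˡ _)
          (telescope-doubled M Gₛ Gₜ (λ k j → sh (pre y (A k)) (B j)) (λ k j → sh (A k) (pre y (B j))) (sh (A M) 1ˢ)
                             (λ j → sh-0l _ ≐-refl) (λ k j → ≐-refl) (λ k j → ≐-refl) ≐-refl w))
  where
  Gₛ Gₜ : ℕ → ℕ → Series
  Gₛ k j = sh (xA₋ y k) (B j)
  Gₜ k j = sh (A k) (xB₋ y j)
  termwise : ∀ k j → δ x (Vterm x y k j) ≐ (Gₛ k j ⊕ Gₛ k j) ⊕ scaleˢ neg1 (Gₜ k j ⊕ Gₜ k j)
  termwise k j = ⊕-cong (⊕-cong (δ-sh-right x (δ-xA₋-other p k) (δ-pre-self x _)) (δ-sh-left x (δ-A′ p k) (δ-B p j)))
                        (scaleˢ-cong neg1 (⊕-cong (δ-sh-right x (δ-A p k) (δ-B′ p j))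
                                                  (δ-sh-left x (δ-pre-self x _) (δ-xB₋-other p j))))

-- The recursion T x (M+1) = −2 · a x x (T y M), obtained by identifying first
-- V, then U, then T through their constant terms and derivatives.

V-closed : ∀ {x y} → BCPair x y → ∀ M → V x y M ≐ scaleˢ neg2 (pre x (T y M))
V-closed {x} {y} p M = series-ext p (trans (V-ε x y M) (sym (*-zeroʳ neg2)))
  (≐-trans (V-a p M) (≐-sym (scaleˢ-vanish neg2 (δa-pre p _))))
  (≐-trans (V-x p M) (≐-sym (scaleˢ-cong neg2 (δ-pre-self x _))))
  (≐-trans (V-y p M) (≐-sym (scaleˢ-vanish neg2 (δ-pre-other (BCPair-sym p) _))))

U-closed : ∀ {x y} → BCPair x y → ∀ M → U x M ≐ scaleˢ neg2 (pre x (pre x (T y M)))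
U-closed {x} p M = series-ext p (trans (U-ε x M) (sym (*-zeroʳ neg2)))
  (≐-trans (U-a p M) (≐-sym (scaleˢ-vanish neg2 (δa-pre p _))))
  (≐-trans (U-x p M) (≐-trans (V-closed p M) (≐-sym (scaleˢ-cong neg2 (δ-pre-self x _)))))
  (≐-trans (U-y p M) (≐-sym (scaleˢ-vanish neg2 (δ-pre-other (BCPair-sym p) _))))

T-step : ∀ {x y} → BCPair x y → ∀ M → T x (suc M) ≐ scaleˢ neg2 (pre a (pre x (pre x (T y M))))
T-step {x} p M = series-ext p (trans (T-ε x M) (sym (*-zeroʳ neg2)))
  (≐-trans (T-a p M) (U-closed p M))
  (≐-trans (T-x p M) (≐-sym (scaleˢ-vanish neg2 (δ-pre-a p _))))
  (≐-trans (T-y p M) (≐-sym (scaleˢ-vanish neg2 (δ-pre-a (BCPair-sym p) _))))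

altWord : Letter → Letter → ℕ → Word
altWord x y zero = []
altWord x y (suc n) = a ∷ x ∷ x ∷ altWord y x n

T-closed : ∀ {x y} → BCPair x y → ∀ N → T x N ≐ scaleˢ (powQ neg2 N) (wordˢ (altWord x y N))
T-closed p zero w = trans (+-identityʳ _) (trans (sh-1l 1ˢ w) (sym (*-identityˡ _)))
T-closed {x} {y} p (suc M) = begin
  T x (suc M)                                         ≈⟨ T-step p M ⟩
  scaleˢ neg2 (pre a (pre x (pre x (T y M))))         ≈⟨ scaleˢ-cong neg2 (pre-cong a (pre-cong x (pre-cong x (T-closed (BCPair-sym p) M)))) ⟩
  scaleˢ neg2 (pre a (pre x (pre x (scaleˢ q W))))    ≈⟨ scaleˢ-cong neg2 pull-scalar ⟩
  scaleˢ neg2 (scaleˢ q (pre a (pre x (pre x W))))    ≈⟨ (λ w → sym (*-assoc neg2 q _)) ⟩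
  scaleˢ (neg2 * q) (wordˢ (altWord x y (suc M)))     ∎
  where
  open SetoidReasoning ≐-setoid
  q : ℚ
  q = powQ neg2 M
  W : Series
  W = wordˢ (altWord y x M)
  pull-scalar : pre a (pre x (pre x (scaleˢ q W))) ≐ scaleˢ q (pre a (pre x (pre x W)))
  pull-scalar = ≐-trans (pre-cong a (≐-trans (pre-cong x (pre-scale x q W)) (pre-scale x q _))) (pre-scale a q _)

RHS-word : ∀ x y n → wpow (a ∷ x ∷ x ∷ a ∷ y ∷ y ∷ []) ⌊ n /2⌋ ++ wpow (a ∷ x ∷ x ∷ []) (n % 2) ≡ altWord x y n
RHS-word x y zero = refl
RHS-word x y (suc zero) = refl
RHS-word x y (suc (suc n)) = cong (λ t → a ∷ x ∷ x ∷ a ∷ y ∷ y ∷ t) (RHS-word x y n)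

RHS-coeff : ∀ x y n → coeff (RHS x y n) ≐ scaleˢ (powQ neg2 n) (wordˢ (altWord x y n))
RHS-coeff x y n w =
  trans (coeff-scale (powQ neg2 n) (word u) w)
        (cong (powQ neg2 n *_) (trans (coeff-word u w) (trans (mono-cong refl (RHS-word x y n) w) (mono-word (altWord x y n) w))))
  where
  u : Word
  u = wpow (a ∷ x ∷ x ∷ a ∷ y ∷ y ∷ []) ⌊ n /2⌋ ++ wpow (a ∷ x ∷ x ∷ []) (n % 2)

BCPair-IsBC : ∀ {x y} → BCPair x y → IsBC x
BCPair-IsBC pbc = isb
BCPair-IsBC pcb = isc

mainTheorem4 : (n : ℕ) → 1 ≤ n →
    (LHS c n ≈ RHS c b n) × (LHS b n ≈ RHS b c n)
mainTheorem4 (suc N) _ = identity pcb , identity pbc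
  where
  identity : ∀ {x y} → BCPair x y → LHS x (suc N) ≈ RHS x y (suc N)
  identity {x} {y} p w =
    trans (LHS≐T (BCPair-IsBC p) N w) (trans (T-closed p (suc N) w) (sym (RHS-coeff x y (suc N) w)))
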